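{- Let $k\ge 2$ be an integer and let ${\bf w}$ be an infinite word that avoids $k$-th powers (contains no factor $u^k$ with $u$ nonempty). Let $N$ be a positive integer. Then for every position $i$, the number of palindromes of the form ${\bf w}[i..j]$ (including the empty one) of length at most $N$ is at most $2+\log_{k/(k-1)}N$.
   Context: ${\bf w}[i..j]$ denotes the factor ${\bf w}[i]{\bf w}[i+1]\cdots{\bf w}[j]$, empty when $j=i-1$. A palindrome is a finite word equal to its reversal; the empty word is a palindrome. -}

module Defs where

open import Data.Nat using (ℕ; _+_; _*_; _<_)
open import Data.List using (List; map; upTo; reverse; concat; replicate)
open import Relation.Binary.PropositionalEquality using (_≡_; _≢_)

Word : Set → Set
Word A = ℕ → A

-- factor w i ℓ = w[i..i+ℓ-1]  (the empty word when ℓ = 0)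
factor : {A : Set} → Word A → ℕ → ℕ → List A
factor w i ℓ = map (λ t → w (i + t)) (upTo ℓ)

IsPalindrome : {A : Set} → List A → Set
IsPalindrome xs = reverse xs ≡ xs

AvoidsPowers : {A : Set} → ℕ → Word A → Set
AvoidsPowers k w =
  ∀ i m → 0 < m → factor w i (k * m) ≢ concat (replicate k (factor w i m))

-- If w[i..i+p-1] and w[i..i+q-1] are palindromes with p < q, then the longer one has period
-- d = q - p (reflect a position in the short palindrome, then back in the long one).  If
-- k d ≤ q, its prefix of length k d would be a k-th power, so q < k d, i.e. k p < (k-1) q.  Along
-- the sorted palindrome lengths 0 ≤ ℓ₀ < ℓ₁ < … < ℓ_{c-1} ≤ N this gives
-- k^(c-2) ≤ k^(c-2) ℓ₁ ≤ (k-1)^(c-2) ℓ_{c-1} ≤ (k-1)^(c-2) N.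
module Submission where

open import Defs
open import Data.Nat
open import Data.Nat.Properties
open import Data.List
  using (List; []; _∷_; _++_; length; reverse; concat; replicate; applyUpTo; applyDownFrom)
open import Data.List.Properties using (map-upTo; reverse-applyUpTo; ∷-injectiveˡ; ∷-injectiveʳ)
open import Data.List.Relation.Unary.All using (All; []; _∷_)
import Data.List.Relation.Unary.All as All
open import Data.List.Relation.Unary.Linked using (Linked; []; [-]; _∷_)
import Data.List.Relation.Unary.Linked as Linked
open import Data.List.Relation.Unary.Linked.Properties using (AllPairs⇒Linked)
open import Data.List.Relation.Unary.Unique.Propositional using (Unique)
open import Data.List.Relation.Binary.Permutation.Propositional using (↭-sym; ↭⇒↭ₛ)
open import Data.List.Relation.Binary.Permutation.Propositional.Properties using (All-resp-↭; ↭-length)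
open import Data.List.Relation.Binary.Permutation.Setoid.Properties using (Unique-resp-↭)
open import Data.List.Sort ≤-decTotalOrder using (sort; sort-↭; sort-↗)
open import Data.Product using (_×_; _,_; proj₁; proj₂; uncurry)
open import Function using (_∘_)
open import Relation.Binary.PropositionalEquality
open import Relation.Nullary using (¬_)

private
  variable
    A : Set

applyUpTo-cong : ∀ {f g : ℕ → A} n → (∀ {t} → t < n → f t ≡ g t) →
  applyUpTo f n ≡ applyUpTo g n
applyUpTo-cong zero    f≗g = refl
applyUpTo-cong (suc n) f≗g = cong₂ _∷_ (f≗g z<s) (applyUpTo-cong n (f≗g ∘ s<s))

applyUpTo-injective : ∀ (f g : ℕ → A) n → applyUpTo f n ≡ applyUpTo g n →
  ∀ {t} → t < n → f t ≡ g t
applyUpTo-injective f g (suc n) eq {zero}  _         = ∷-injectiveˡ eq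
applyUpTo-injective f g (suc n) eq {suc t} (s<s t<n) =
  applyUpTo-injective (f ∘ suc) (g ∘ suc) n (∷-injectiveʳ eq) t<n

applyUpTo-++ : ∀ (f : ℕ → A) m n → applyUpTo f (m + n) ≡ applyUpTo f m ++ applyUpTo (f ∘ (m +_)) n
applyUpTo-++ f zero    n = refl
applyUpTo-++ f (suc m) n = cong (f 0 ∷_) (applyUpTo-++ (f ∘ suc) m n)

applyDownFrom-applyUpTo : ∀ (f : ℕ → A) n → applyDownFrom f n ≡ applyUpTo (λ t → f (n ∸ suc t)) n
applyDownFrom-applyUpTo f zero    = refl
applyDownFrom-applyUpTo f (suc n) = cong (f n ∷_) (applyDownFrom-applyUpTo f n)

applyUpTo-periodic : ∀ (f : ℕ → A) d m → (∀ {t} → t + d < m * d → f t ≡ f (d + t)) →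
  applyUpTo f (m * d) ≡ concat (replicate m (applyUpTo f d))
applyUpTo-periodic f d zero    periodic = refl
applyUpTo-periodic f d (suc m) periodic = begin
  applyUpTo f (d + m * d)                           ≡⟨ applyUpTo-++ f d (m * d) ⟩
  applyUpTo f d ++ applyUpTo (f ∘ (d +_)) (m * d)   ≡⟨ cong (applyUpTo f d ++_) shifted ⟩
  applyUpTo f d ++ applyUpTo f (m * d)              ≡⟨ cong (applyUpTo f d ++_) rest ⟩
  applyUpTo f d ++ concat (replicate m (applyUpTo f d)) ∎
  where
  open ≡-Reasoning
  shifted : applyUpTo (f ∘ (d +_)) (m * d) ≡ applyUpTo f (m * d)
  shifted = applyUpTo-cong (m * d) λ {t} t<md →
    sym (periodic (subst (_< d + m * d) (+-comm d t) (+-monoʳ-< d t<md)))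
  rest : applyUpTo f (m * d) ≡ concat (replicate m (applyUpTo f d))
  rest = applyUpTo-periodic f d m (λ lt → periodic (<-≤-trans lt (m≤n+m (m * d) d)))

module _ (w : Word A) (i : ℕ) where

  factor-applyUpTo : ∀ n → factor w i n ≡ applyUpTo (λ t → w (i + t)) n
  factor-applyUpTo = map-upTo (λ t → w (i + t))

  palindrome-mirror : ∀ s t → IsPalindrome (factor w i (suc (s + t))) → w (i + s) ≡ w (i + t)
  palindrome-mirror s t pal = subst (λ u → w (i + u) ≡ w (i + t)) (m+n∸n≡m s t)
    (applyUpTo-injective (λ u → w (i + (n ∸ suc u))) (λ u → w (i + u)) n reflected (s≤s (m≤n+m t s)))
    where
    n = suc (s + t)
    reflected : applyUpTo (λ u → w (i + (n ∸ suc u))) n ≡ applyUpTo (λ u → w (i + u)) n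
    reflected = begin
      applyUpTo (λ u → w (i + (n ∸ suc u))) n   ≡⟨ applyDownFrom-applyUpTo _ n ⟨
      applyDownFrom (λ u → w (i + u)) n         ≡⟨ reverse-applyUpTo _ n ⟨
      reverse (applyUpTo (λ u → w (i + u)) n)   ≡⟨ cong reverse (factor-applyUpTo n) ⟨
      reverse (factor w i n)                    ≡⟨ pal ⟩
      factor w i n                              ≡⟨ factor-applyUpTo n ⟩
      applyUpTo (λ u → w (i + u)) n             ∎
      where open ≡-Reasoning

  palindromicPrefixes-period : ∀ {p d t} → IsPalindrome (factor w i p) →
    IsPalindrome (factor w i (p + d)) → t < p → w (i + t) ≡ w (i + (d + t))
  palindromicPrefixes-period {p} {d} {t} palp palpd t<p with m≤n⇒∃[o]m+o≡n t<p
  ... | s , refl = begin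
    w (i + t)        ≡⟨ palindrome-mirror s t (subst (IsPalindrome ∘ factor w i) t+s≡s+t palp) ⟨
    w (i + s)        ≡⟨ palindrome-mirror s (d + t) (subst (IsPalindrome ∘ factor w i) t+s+d≡s+[d+t] palpd) ⟩
    w (i + (d + t))  ∎
    where
    open ≡-Reasoning
    t+s≡s+t : suc t + s ≡ suc (s + t)
    t+s≡s+t = cong suc (+-comm t s)
    t+s+d≡s+[d+t] : suc t + s + d ≡ suc (s + (d + t))
    t+s+d≡s+[d+t] = cong suc (trans (cong (_+ d) (+-comm t s))
                                    (trans (+-assoc s t d) (cong (s +_) (+-comm t d))))

gap⇒ratio : ∀ k {p d} → p + d < k * d → k * p ≤ (k ∸ 1) * (p + d)
gap⇒ratio zero    ()
gap⇒ratio (suc k) {p} {d} p+d<kd = begin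
  p + k * p      ≤⟨ +-monoˡ-≤ (k * p) (<⇒≤ p<kd) ⟩
  k * d + k * p  ≡⟨ +-comm (k * d) (k * p) ⟩
  k * p + k * d  ≡⟨ *-distribˡ-+ k p d ⟨
  k * (p + d)    ∎
  where
  open ≤-Reasoning
  p<kd : p < k * d
  p<kd = +-cancelˡ-< d p (k * d) (subst (_< d + k * d) (+-comm p d) p+d<kd)

module _ (k : ℕ) (w : Word A) (avoids : AvoidsPowers k w) (i : ℕ) where

  palindromicPrefixes-gap : ∀ {p d} → 0 < d → IsPalindrome (factor w i p) →
    IsPalindrome (factor w i (p + d)) → p + d < k * d
  palindromicPrefixes-gap {p} {d} d>0 palp palpd = ≰⇒> kd≰p+d
    where
    kd≰p+d : ¬ (k * d ≤ p + d)
    kd≰p+d kd≤p+d = avoids i d d>0 (begin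
      factor w i (k * d)                                    ≡⟨ factor-applyUpTo w i (k * d) ⟩
      applyUpTo (λ t → w (i + t)) (k * d)                   ≡⟨ applyUpTo-periodic _ d k period ⟩
      concat (replicate k (applyUpTo (λ t → w (i + t)) d))  ≡⟨ cong (concat ∘ replicate k) (factor-applyUpTo w i d) ⟨
      concat (replicate k (factor w i d))                   ∎)
      where
      open ≡-Reasoning
      period : ∀ {t} → t + d < k * d → w (i + t) ≡ w (i + (d + t))
      period t+d<kd = palindromicPrefixes-period w i palp palpd
        (+-cancelʳ-< d _ p (<-≤-trans t+d<kd kd≤p+d))

  palindromicPrefixes-ratio : ∀ {p q} → p < q → IsPalindrome (factor w i p) →
    IsPalindrome (factor w i q) → k * p ≤ (k ∸ 1) * q
  palindromicPrefixes-ratio {p} p<q palp palq with m≤n⇒∃[o]m+o≡n p<q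
  ... | d , refl = subst (λ q → k * p ≤ (k ∸ 1) * q) (+-suc p d)
    (gap⇒ratio k (palindromicPrefixes-gap z<s palp (subst (IsPalindrome ∘ factor w i) (sym (+-suc p d)) palq)))

  palindromicPrefixes-ratios : ∀ {ls} → Linked _<_ ls → All (IsPalindrome ∘ factor w i) ls →
    Linked (λ p q → k * p ≤ (k ∸ 1) * q) ls
  palindromicPrefixes-ratios []                _                     = []
  palindromicPrefixes-ratios [-]               _                     = [-]
  palindromicPrefixes-ratios (p<q ∷ increasing) (palp ∷ pals@(palq ∷ _)) =
    palindromicPrefixes-ratio p<q palp palq ∷ palindromicPrefixes-ratios increasing pals

geometricDecay : ∀ {a b N x} xs → Linked (λ x y → a * x ≤ b * y) (x ∷ xs) → All (_≤ N) (x ∷ xs) →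
  a ^ length xs * x ≤ b ^ length xs * N
geometricDecay []       _ (x≤N ∷ _) = *-monoʳ-≤ 1 x≤N
geometricDecay {a} {b} {N} {x} (y ∷ ys) (ax≤by ∷ decay) (_ ∷ bounded) = begin
  (a * a′) * x        ≡⟨ cong (_* x) (*-comm a a′) ⟩
  (a′ * a) * x        ≡⟨ *-assoc a′ a x ⟩
  a′ * (a * x)        ≤⟨ *-monoʳ-≤ a′ ax≤by ⟩
  a′ * (b * y)        ≡⟨ *-assoc a′ b y ⟨
  (a′ * b) * y        ≡⟨ cong (_* y) (*-comm a′ b) ⟩
  (b * a′) * y        ≡⟨ *-assoc b a′ y ⟩
  b * (a′ * y)        ≤⟨ *-monoʳ-≤ b (geometricDecay ys decay bounded) ⟩
  b * (b′ * N)        ≡⟨ *-assoc b b′ N ⟨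
  (b * b′) * N        ∎
  where
  open ≤-Reasoning
  a′ = a ^ length ys
  b′ = b ^ length ys

module _ (k : ℕ) (w : Word A) (avoids : AvoidsPowers k w) {N : ℕ} (N≥1 : 1 ≤ N) (i : ℕ) where

  increasingPalindromicPrefixes-bound : ∀ {ls} → Linked _<_ ls →
    All (λ ℓ → ℓ ≤ N × IsPalindrome (factor w i ℓ)) ls →
    k ^ (length ls ∸ 2) ≤ N * (k ∸ 1) ^ (length ls ∸ 2)
  increasingPalindromicPrefixes-bound {[]}    _ _ = subst (1 ≤_) (sym (*-identityʳ N)) N≥1
  increasingPalindromicPrefixes-bound {_ ∷ []} _ _ = subst (1 ≤_) (sym (*-identityʳ N)) N≥1
  increasingPalindromicPrefixes-bound {x ∷ y ∷ ys} (x<y ∷ increasing) (_ ∷ prefixes) = begin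
    k ^ length ys                ≤⟨ m≤m*n (k ^ length ys) y ⟩
    k ^ length ys * y            ≤⟨ geometricDecay ys ratios (All.map proj₁ prefixes) ⟩
    (k ∸ 1) ^ length ys * N      ≡⟨ *-comm _ N ⟩
    N * (k ∸ 1) ^ length ys      ∎
    where
    open ≤-Reasoning
    instance
      y≢0 : NonZero y
      y≢0 = >-nonZero (≤-<-trans z≤n x<y)
    ratios : Linked (λ p q → k * p ≤ (k ∸ 1) * q) (y ∷ ys)
    ratios = palindromicPrefixes-ratios k w avoids i increasing (All.map proj₂ prefixes)

sort-unique-increasing : ∀ {ls} → Unique ls → Linked _<_ (sort ls)
sort-unique-increasing {ls} unique = Linked.zipWith (uncurry ≤∧≢⇒<)
  (sort-↗ ls , AllPairs⇒Linked (Unique-resp-↭ (setoid ℕ) (↭⇒↭ₛ (↭-sym (sort-↭ ls))) unique))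

mainTheorem7 : {A : Set} (k : ℕ) → 2 ≤ k → (w : Word A) → AvoidsPowers k w →
    (N : ℕ) → 1 ≤ N → (i : ℕ) → (ls : List ℕ) → Unique ls →
    All (λ ℓ → ℓ ≤ N × IsPalindrome (factor w i ℓ)) ls →
    k ^ (length ls ∸ 2) ≤ N * (k ∸ 1) ^ (length ls ∸ 2)
mainTheorem7 k _ w avoids N N≥1 i ls unique prefixes =
  subst (λ c → k ^ (c ∸ 2) ≤ N * (k ∸ 1) ^ (c ∸ 2)) (↭-length (sort-↭ ls))
    (increasingPalindromicPrefixes-bound k w avoids N≥1 i (sort-unique-increasing unique)
      (All-resp-↭ (↭-sym (sort-↭ ls)) prefixes))
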